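{- Let $G$ be a finite simple graph and let $I$ be a maximum critical independent set of $G$. Then for every maximum matching $M$ of $L_G$, \[ \mathrm{core}(G)=\mathrm{core}(L_G^c)\cup M\bigl(N(I)-\mathrm{corona}(G)\bigr)\cup \ker(G). \]
   Context: All graphs are finite and simple. For $X\subseteq V(G)$, $N(X)$ is the union of neighborhoods of the vertices of $X$. $\Omega(G)$ is the family of maximum independent sets of $G$; $\mathrm{core}(G)=\bigcap\Omega(G)$, $\mathrm{corona}(G)=\bigcup\Omega(G)$ (the core of the graph with no vertices is $\emptyset$). An independent set $I$ of $G$ is critical if $|I|-|N(I)|\ge |J|-|N(J)|$ for every independent set $J$ of $G$; a maximum critical independent set is a critical independent set of maximum cardinality among critical independent sets. $\ker(G)$ is the intersection of all critical independent sets of $G$. $L(G)$ denotes the set $J\cup N(J)$ for any maximum critical independent set $J$ of $G$ (this set does not depend on the choice of $J$); $L^c(G)=V(G)-L(G)$, $L_G=G[L(G)]$ and $L_G^c=G[L^c(G)]$. For a matching $M$ and a vertex $v$, $M(v)=u$ if $uv\in M$ and $M(v)=v$ otherwise; $M(S)=\{M(v):v\in S\}$. -}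

module Defs where

open import Data.Nat using (ℕ; _+_; _≤_)
open import Data.Bool using (Bool; true; false; _∧_)
open import Data.Fin using (Fin)
open import Data.Fin.Subset using (Subset; _∈_; _∉_; _⊆_; _∪_; ∁; ∣_∣)
open import Data.Vec using (tabulate; lookup)
open import Data.Vec.Functional using () 
open import Data.List using (List; length)
open import Data.List.Relation.Unary.All using (All)
open import Data.List.Relation.Unary.Any using (Any)
open import Data.List.Relation.Unary.AllPairs using (AllPairs)
open import Data.Product using (_×_; Σ; proj₁; proj₂; ∃)
open import Data.Sum using (_⊎_)
open import Relation.Binary.PropositionalEquality using (_≡_; _≢_)
open import Relation.Nullary using (¬_)
open import Data.Fin using (toℕ)

record Graph (n : ℕ) : Set where
  field
    adj    : Fin n → Fin n → Bool
    adj-sym    : ∀ u v → adj u v ≡ adj v u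
    adj-irrefl : ∀ v → adj v v ≡ false
open Graph public

module _ {n : ℕ} (G : Graph n) where

  private
    anyFin : ∀ {m} → (Fin m → Bool) → Bool
    anyFin {ℕ.zero} f = false
    anyFin {ℕ.suc m} f = Data.Bool._∨_ (f Fin.zero) (anyFin (λ i → f (Fin.suc i)))

  N : Subset n → Subset n
  N X = tabulate (λ v → anyFin (λ u → lookup X u ∧ adj G u v))

  Independent : Subset n → Set
  Independent S = ∀ u v → u ∈ S → v ∈ S → adj G u v ≡ false

  -- Maximum independent set of the induced subgraph G[X]
  -- (X = all vertices gives the maximum independent sets of G).
  MaxIndepIn : Subset n → Subset n → Set
  MaxIndepIn X S = S ⊆ X × Independent S
    × (∀ T → T ⊆ X → Independent T → ∣ T ∣ ≤ ∣ S ∣)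

  InCoreIn : Subset n → Fin n → Set
  InCoreIn X v = ∀ S → MaxIndepIn X S → v ∈ S

  MaxIndep : Subset n → Set
  MaxIndep S = Independent S × (∀ T → Independent T → ∣ T ∣ ≤ ∣ S ∣)

  InCore : Fin n → Set
  InCore v = ∀ S → MaxIndep S → v ∈ S

  InCorona : Fin n → Set
  InCorona v = Σ (Subset n) λ S → MaxIndep S × v ∈ S

  -- critical independent set: |I| - |N(I)| ≥ |J| - |N(J)| for every
  -- independent J (written without subtraction: |J| + |N(I)| ≤ |I| + |N(J)|)
  Critical : Subset n → Set
  Critical I = Independent I
    × (∀ J → Independent J → ∣ J ∣ + ∣ N I ∣ ≤ ∣ I ∣ + ∣ N J ∣)

  MaxCritical : Subset n → Set
  MaxCritical I = Critical I × (∀ J → Critical J → ∣ J ∣ ≤ ∣ I ∣)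

  InKer : Fin n → Set
  InKer v = ∀ S → Critical S → v ∈ S

  -- L(G) = J ∪ N(J) for a maximum critical independent set J,
  -- and its complement L^c(G)
  Lset : Subset n → Subset n
  Lset J = J ∪ N J

  Lcset : Subset n → Subset n
  Lcset J = ∁ (Lset J)

  Edge : Set
  Edge = Fin n × Fin n

  DisjointEdges : Edge → Edge → Set
  DisjointEdges e f = proj₁ e ≢ proj₁ f × proj₁ e ≢ proj₂ f
                    × proj₂ e ≢ proj₁ f × proj₂ e ≢ proj₂ f

  IsMatchingIn : Subset n → List Edge → Set
  IsMatchingIn X M =
    All (λ e → adj G (proj₁ e) (proj₂ e) ≡ true × proj₁ e ∈ X × proj₂ e ∈ X) M
    × AllPairs DisjointEdges M

  IsMaxMatchingIn : Subset n → List Edge → Set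
  IsMaxMatchingIn X M = IsMatchingIn X M
    × (∀ M′ → IsMatchingIn X M′ → length M′ ≤ length M)

-- M(v) = u if uv ∈ M, M(v) = v if v is not covered by M;
-- MapsTo M v w means M(v) = w.
module _ {n : ℕ} where
  Covered : List (Fin n × Fin n) → Fin n → Set
  Covered M v = Any (λ e → proj₁ e ≡ v ⊎ proj₂ e ≡ v) M

  MapsTo : List (Fin n × Fin n) → Fin n → Fin n → Set
  MapsTo M v w =
    Any (λ e → (proj₁ e ≡ v × proj₂ e ≡ w) ⊎ (proj₂ e ≡ v × proj₁ e ≡ w)) M
    ⊎ (¬ Covered M v × w ≡ v)

  InImage : List (Fin n × Fin n) → (Fin n → Set) → Fin n → Set
  InImage M S w = Σ (Fin n) λ v → S v × MapsTo M v w

{-# OPTIONS --safe #-}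
module Submission where

-- A critical independent set I satisfies Hall's condition from N(I) into I, so a maximum
-- matching M of G[L] matches N(I) injectively into I. Counting along u ↦ M(u) gives
-- |S ∩ N(I)| ≤ |I − S| for independent S; hence α(G) = |I| + α(G[L^c]), S ∩ L^c is maximum
-- in G[L^c] for S ∈ Ω(G), and I ∪ B ∈ Ω(G) for every maximum independent B of G[L^c]. This
-- gives core(G) − L = core(G[L^c]) and core(G) ∩ L ⊆ I. A core vertex v ∈ I is either M(u)
-- for some u ∈ N(I), and u lies outside the corona since it is adjacent to v; or v is missed
-- by M(N(I)), and then v lies in every critical J, as otherwise I would have a strictly
-- larger surplus than the critical set I ∩ J. Conversely M(u) ∈ S for u ∈ N(I) − corona(G)
-- and S ∈ Ω(G), since otherwise S ∩ N(I) would inject into (I − S) − M(u); and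
-- ker(G) ⊆ core(G) because I ∩ S is critical for every S ∈ Ω(G).

open import Defs
open import Data.Bool using (Bool; true; false; _∧_; _∨_; if_then_else_)
open import Data.Bool.Properties using (∨-zeroʳ; ¬-not) renaming (_≟_ to _≟ᵇ_)
open import Data.Empty using (⊥; ⊥-elim)
open import Data.Fin using (Fin; zero; suc)
open import Data.Fin.Properties using (_≟_; any?; all?; suc-injective)
open import Data.Fin.Subset
  using (Subset; inside; outside; _∈_; _∉_; _⊆_; _∪_; _∩_; ∁; ⁅_⁆; ∣_∣; Nonempty; Empty)
  renaming (⊥ to ∅)
open import Data.Fin.Subset.Properties
  using ( _∈?_; nonempty?; anySubset?; _⊆?_; Empty-unique; ∣⊥∣≡0; ∣⁅x⁆∣≡1; x∈⁅x⁆; x∈⁅y⁆⇒x≡y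
        ; x≢y⇒x∉⁅y⁆; p⊆q⇒∣p∣≤∣q∣; ∣p∩q∣≤∣q∣; p∩q⊆p; p∩q⊆q; x∈p∩q⁺; x∈p∩q⁻
        ; p⊆p∪q; q⊆p∪q; x∈p∪q⁺; x∈p∪q⁻; x∈∁p⇒x∉p; x∉p⇒x∈∁p; ∉⊥; ∪-comm)
open import Data.List using (List; []; _∷_; length; map)
open import Data.List.Properties using (length-map)
open import Data.List.Relation.Unary.All as All using (All; []; _∷_)
open import Data.List.Relation.Unary.All.Properties as All using ()
open import Data.List.Relation.Unary.Any as Any using (Any)
open import Data.List.Relation.Unary.AllPairs as AllPairs using (AllPairs; []; _∷_)
open import Data.List.Relation.Unary.AllPairs.Properties as AllPairs using ()
open import Data.List.Relation.Unary.Unique.Propositional using (Unique)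
open import Data.List.Relation.Unary.Unique.Propositional.Properties as Unique using ()
open import Data.Nat using (ℕ; zero; suc; _+_; _≤_; _<_; z≤n; _≤?_; _<?_)
open import Data.Nat.Tactic.RingSolver using (solve-∀)
open import Data.Nat.Properties hiding (suc-injective; _≟_)
open import Data.Product using (_×_; _,_; proj₁; proj₂; ∃)
open import Data.Sum using (_⊎_; inj₁; inj₂)
open import Data.Vec using (_∷_; []; lookup; here; there)
open import Data.Vec.Properties using (lookup∘tabulate; []=⇒lookup; lookup⇒[]=)
open import Function using (_∘_; case_of_)
open import Function.Bundles using (_⇔_; mk⇔)
open import Relation.Binary.PropositionalEquality using (_≡_; _≢_; refl; sym; trans; cong; subst)
open import Relation.Nullary using (¬_; Dec; yes; no; does; contradiction)
open import Relation.Nullary.Decidable using (_×-dec_; _⊎-dec_; _→-dec_)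
open import Relation.Unary using (Decidable)

open ≤-Reasoning

-- Sizes of subsets

∣p∣≡∣p∩q∣+∣p∩∁q∣ : ∀ {n} (p q : Subset n) → ∣ p ∣ ≡ ∣ p ∩ q ∣ + ∣ p ∩ ∁ q ∣
∣p∣≡∣p∩q∣+∣p∩∁q∣ []            []            = refl
∣p∣≡∣p∩q∣+∣p∩∁q∣ (inside  ∷ p) (inside  ∷ q) = cong suc (∣p∣≡∣p∩q∣+∣p∩∁q∣ p q)
∣p∣≡∣p∩q∣+∣p∩∁q∣ (inside  ∷ p) (outside ∷ q) =
  trans (cong suc (∣p∣≡∣p∩q∣+∣p∩∁q∣ p q)) (sym (+-suc _ _))
∣p∣≡∣p∩q∣+∣p∩∁q∣ (outside ∷ p) (_       ∷ q) = ∣p∣≡∣p∩q∣+∣p∩∁q∣ p q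

∣p∪q∣+∣p∩q∣≡∣p∣+∣q∣ : ∀ {n} (p q : Subset n) → ∣ p ∪ q ∣ + ∣ p ∩ q ∣ ≡ ∣ p ∣ + ∣ q ∣
∣p∪q∣+∣p∩q∣≡∣p∣+∣q∣ []            []            = refl
∣p∪q∣+∣p∩q∣≡∣p∣+∣q∣ (inside  ∷ p) (inside  ∷ q) =
  cong suc (trans (+-suc _ _) (trans (cong suc (∣p∪q∣+∣p∩q∣≡∣p∣+∣q∣ p q)) (sym (+-suc _ _))))
∣p∪q∣+∣p∩q∣≡∣p∣+∣q∣ (inside  ∷ p) (outside ∷ q) = cong suc (∣p∪q∣+∣p∩q∣≡∣p∣+∣q∣ p q)
∣p∪q∣+∣p∩q∣≡∣p∣+∣q∣ (outside ∷ p) (inside  ∷ q) =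
  trans (cong suc (∣p∪q∣+∣p∩q∣≡∣p∣+∣q∣ p q)) (sym (+-suc _ _))
∣p∪q∣+∣p∩q∣≡∣p∣+∣q∣ (outside ∷ p) (outside ∷ q) = ∣p∪q∣+∣p∩q∣≡∣p∣+∣q∣ p q

∣p∪q∣≤∣p∣+∣q∣ : ∀ {n} (p q : Subset n) → ∣ p ∪ q ∣ ≤ ∣ p ∣ + ∣ q ∣
∣p∪q∣≤∣p∣+∣q∣ p q = subst (∣ p ∪ q ∣ ≤_) (∣p∪q∣+∣p∩q∣≡∣p∣+∣q∣ p q) (m≤m+n _ _)

∣Empty∣≡0 : ∀ {n} {p : Subset n} → Empty p → ∣ p ∣ ≡ 0
∣Empty∣≡0 {n} p-empty = trans (cong ∣_∣ (Empty-unique p-empty)) (∣⊥∣≡0 n)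

∣p∪q∣≡∣p∣+∣q∣ : ∀ {n} (p q : Subset n) → (∀ {x} → x ∈ p → x ∉ q) → ∣ p ∪ q ∣ ≡ ∣ p ∣ + ∣ q ∣
∣p∪q∣≡∣p∣+∣q∣ p q disjoint = begin-equality
  ∣ p ∪ q ∣              ≡⟨ +-identityʳ _ ⟨
  ∣ p ∪ q ∣ + 0          ≡⟨ cong (∣ p ∪ q ∣ +_) (∣Empty∣≡0 p∩q-empty) ⟨
  ∣ p ∪ q ∣ + ∣ p ∩ q ∣  ≡⟨ ∣p∪q∣+∣p∩q∣≡∣p∣+∣q∣ p q ⟩
  ∣ p ∣ + ∣ q ∣          ∎
  where
  p∩q-empty : Empty (p ∩ q)
  p∩q-empty (x , x∈p∩q) = disjoint (p∩q⊆p p q x∈p∩q) (p∩q⊆q p q x∈p∩q)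

x∈p⇒0<∣p∣ : ∀ {n} {p : Subset n} {x} → x ∈ p → 0 < ∣ p ∣
x∈p⇒0<∣p∣ {p = p} {x} x∈p = subst (_≤ ∣ p ∣) (∣⁅x⁆∣≡1 x) (p⊆q⇒∣p∣≤∣q∣ ⁅x⁆⊆p)
  where
  ⁅x⁆⊆p : ⁅ x ⁆ ⊆ p
  ⁅x⁆⊆p y∈⁅x⁆ = subst (_∈ p) (sym (x∈⁅y⁆⇒x≡y x y∈⁅x⁆)) x∈p

0<∣p∣⇒Nonempty : ∀ {n} (p : Subset n) → 0 < ∣ p ∣ → Nonempty p
0<∣p∣⇒Nonempty p 0<∣p∣ with nonempty? p
... | yes p-nonempty = p-nonempty
... | no  p-empty    = contradiction (subst (0 <_) (∣Empty∣≡0 p-empty) 0<∣p∣) (<-irrefl refl)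

x∈p∩q⇒∣p∩∁q∣<∣p∣ : ∀ {n} {p q : Subset n} {x} → x ∈ p ∩ q → ∣ p ∩ ∁ q ∣ < ∣ p ∣
x∈p∩q⇒∣p∩∁q∣<∣p∣ {p = p} {q} x∈p∩q = begin-strict
  ∣ p ∩ ∁ q ∣              <⟨ +-monoˡ-< ∣ p ∩ ∁ q ∣ (x∈p⇒0<∣p∣ x∈p∩q) ⟩
  ∣ p ∩ q ∣ + ∣ p ∩ ∁ q ∣  ≡⟨ ∣p∣≡∣p∩q∣+∣p∩∁q∣ p q ⟨
  ∣ p ∣                    ∎

x∈p⇒∣p∩∁⁅x⁆∣<∣p∣ : ∀ {n} {p : Subset n} {x} → x ∈ p → ∣ p ∩ ∁ ⁅ x ⁆ ∣ < ∣ p ∣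
x∈p⇒∣p∩∁⁅x⁆∣<∣p∣ {x = x} x∈p = x∈p∩q⇒∣p∩∁q∣<∣p∣ (x∈p∩q⁺ (x∈p , x∈⁅x⁆ x))

x∈p∧x≢y⇒x∈p∩∁⁅y⁆ : ∀ {n} {p : Subset n} {x y} → x ∈ p → x ≢ y → x ∈ p ∩ ∁ ⁅ y ⁆
x∈p∧x≢y⇒x∈p∩∁⁅y⁆ x∈p x≢y = x∈p∩q⁺ (x∈p , x∉p⇒x∈∁p (x≢y⇒x∉⁅y⁆ x≢y))

AllPairs-map-within : ∀ {A : Set} {P : A → Set} {R S : A → A → Set} →
  (∀ {x y} → P x → P y → R x y → S x y) →
  ∀ {xs} → All P xs → AllPairs R xs → AllPairs S xs
AllPairs-map-within f []         []         = []
AllPairs-map-within f (px ∷ pxs) (rx ∷ rxs) =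
  All.zipWith (λ (py , rxy) → f px py rxy) (pxs , rx) ∷ AllPairs-map-within f pxs rxs

Unique⇒length≤∣p∣ : ∀ {n} (p : Subset n) {xs} → All (_∈ p) xs → Unique xs → length xs ≤ ∣ p ∣
Unique⇒length≤∣p∣ p {[]}     []           []            = z≤n
Unique⇒length≤∣p∣ p {x ∷ xs} (x∈p ∷ xs⊆p) (x∉xs ∷ xs!) = begin-strict
  length xs        ≤⟨ Unique⇒length≤∣p∣ (p ∩ ∁ ⁅ x ⁆) xs⊆p-x xs! ⟩
  ∣ p ∩ ∁ ⁅ x ⁆ ∣  <⟨ x∈p⇒∣p∩∁⁅x⁆∣<∣p∣ x∈p ⟩
  ∣ p ∣            ∎
  where
  xs⊆p-x : All (_∈ p ∩ ∁ ⁅ x ⁆) xs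
  xs⊆p-x = All.zipWith (λ (y∈p , x≢y) → x∈p∧x≢y⇒x∈p∩∁⁅y⁆ y∈p (x≢y ∘ sym)) (xs⊆p , x∉xs)

elements : ∀ {n} → Subset n → List (Fin n)
elements []            = []
elements (inside  ∷ p) = zero ∷ map suc (elements p)
elements (outside ∷ p) = map suc (elements p)

length-elements : ∀ {n} (p : Subset n) → length (elements p) ≡ ∣ p ∣
length-elements []            = refl
length-elements (inside  ∷ p) = cong suc (trans (length-map suc (elements p)) (length-elements p))
length-elements (outside ∷ p) = trans (length-map suc (elements p)) (length-elements p)

elements⊆ : ∀ {n} (p : Subset n) → All (_∈ p) (elements p)
elements⊆ []            = []
elements⊆ (inside  ∷ p) = here ∷ All.map⁺ (All.map there (elements⊆ p))
elements⊆ (outside ∷ p) = All.map⁺ (All.map there (elements⊆ p))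

elements-unique : ∀ {n} (p : Subset n) → Unique (elements p)
elements-unique []            = []
elements-unique (inside  ∷ p) =
  All.map⁺ (All.universal (λ _ ()) _) ∷ Unique.map⁺ suc-injective (elements-unique p)
elements-unique (outside ∷ p) = Unique.map⁺ suc-injective (elements-unique p)

injective⇒∣p∣≤∣q∣ : ∀ {n} {p q : Subset n} (f : Fin n → Fin n) →
  (∀ {x} → x ∈ p → f x ∈ q) → (∀ {x y} → x ∈ p → y ∈ p → f x ≡ f y → x ≡ y) →
  ∣ p ∣ ≤ ∣ q ∣
injective⇒∣p∣≤∣q∣ {p = p} {q} f f∈q f-injective = begin
  ∣ p ∣                        ≡⟨ length-elements p ⟨
  length (elements p)          ≡⟨ length-map f (elements p) ⟨
  length (map f (elements p))  ≤⟨ Unique⇒length≤∣p∣ q image⊆q image-unique ⟩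
  ∣ q ∣                        ∎
  where
  image⊆q : All (_∈ q) (map f (elements p))
  image⊆q = All.map⁺ (All.map f∈q (elements⊆ p))
  image-unique : Unique (map f (elements p))
  image-unique = AllPairs.map⁺ (AllPairs-map-within (λ x∈p y∈p x≢y → x≢y ∘ f-injective x∈p y∈p)
                                                    (elements⊆ p) (elements-unique p))

argmax : ∀ {n} {P : Subset n → Set} → Decidable P → (w : Subset n → ℕ) →
  (∀ S → ¬ P S) ⊎ ∃ λ S → P S × ∀ T → P T → w T ≤ w S
argmax {zero} P? w with P? []
... | yes P[] = inj₂ ([] , P[] , λ { [] _ → ≤-refl })
... | no ¬P[] = inj₁ λ { [] → ¬P[] }
argmax {suc n} P? w with argmax (P? ∘ (outside ∷_)) (w ∘ (outside ∷_))
                       | argmax (P? ∘ (inside ∷_))  (w ∘ (inside ∷_))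
... | inj₁ none₀ | inj₁ none₁ = inj₁ λ { (outside ∷ S) → none₀ S ; (inside ∷ S) → none₁ S }
... | inj₁ none₀ | inj₂ (S , PS , max) =
  inj₂ (inside ∷ S , PS , λ { (outside ∷ T) PT → contradiction PT (none₀ T) ; (inside ∷ T) → max T })
... | inj₂ (S , PS , max) | inj₁ none₁ =
  inj₂ (outside ∷ S , PS , λ { (outside ∷ T) → max T ; (inside ∷ T) PT → contradiction PT (none₁ T) })
... | inj₂ (S₀ , PS₀ , max₀) | inj₂ (S₁ , PS₁ , max₁) with w (outside ∷ S₀) ≤? w (inside ∷ S₁)
...   | yes w₀≤w₁ = inj₂ (inside ∷ S₁ , PS₁ ,
          λ { (outside ∷ T) PT → ≤-trans (max₀ T PT) w₀≤w₁ ; (inside ∷ T) → max₁ T })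
...   | no  w₀≰w₁ = inj₂ (outside ∷ S₀ , PS₀ ,
          λ { (outside ∷ T) → max₀ T ; (inside ∷ T) PT → ≤-trans (max₁ T PT) (<⇒≤ (≰⇒> w₀≰w₁)) })

-- Neighbourhoods, independent sets and Hall's theorem

-- `N` is computed by a boolean search over the vertices that Defs keeps private. On a star
-- graph centred at vertex zero, `N` runs that search on an arbitrary predicate, which lets us
-- reason about it by induction on the subset.
private
  star : ∀ {m} → (Fin m → Bool) → Graph (suc m)
  star {m} k = record { adj = edge ; adj-sym = edge-sym ; adj-irrefl = edge-irrefl }
    where
    edge : Fin (suc m) → Fin (suc m) → Bool
    edge zero    zero    = false
    edge zero    (suc j) = k j
    edge (suc i) zero    = k i
    edge (suc i) (suc j) = false
    edge-sym : ∀ u v → edge u v ≡ edge v u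
    edge-sym zero    zero    = refl
    edge-sym zero    (suc j) = refl
    edge-sym (suc i) zero    = refl
    edge-sym (suc i) (suc j) = refl
    edge-irrefl : ∀ v → edge v v ≡ false
    edge-irrefl zero    = refl
    edge-irrefl (suc i) = refl

  anyIn : ∀ {m} → Subset m → (Fin m → Bool) → Bool
  anyIn Y k = lookup (N (star k) (outside ∷ Y)) zero

  anyIn-true⁻ : ∀ {m} (Y : Subset m) k → anyIn Y k ≡ true → ∃ λ i → i ∈ Y × k i ≡ true
  anyIn-true⁻ (inside ∷ Y) k h with k zero in k₀
  ... | true  = zero , here , k₀
  ... | false = let i , i∈Y , kᵢ = anyIn-true⁻ Y (k ∘ suc) h in suc i , there i∈Y , kᵢ
  anyIn-true⁻ (outside ∷ Y) k h =
    let i , i∈Y , kᵢ = anyIn-true⁻ Y (k ∘ suc) h in suc i , there i∈Y , kᵢ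

  anyIn-true⁺ : ∀ {m} (Y : Subset m) k {i} → i ∈ Y → k i ≡ true → anyIn Y k ≡ true
  anyIn-true⁺ (inside ∷ Y) k here        kᵢ = cong (_∨ anyIn Y (k ∘ suc)) kᵢ
  anyIn-true⁺ (s      ∷ Y) k (there i∈Y) kᵢ =
    trans (cong ((s ∧ k zero) ∨_) (anyIn-true⁺ Y (k ∘ suc) i∈Y kᵢ)) (∨-zeroʳ _)

module _ {n : ℕ} (G : Graph n) where

  private
    lookup-N : ∀ X v → lookup (N G X) v ≡ anyIn X (λ u → adj G u v)
    lookup-N X v = lookup∘tabulate _ v

  ∈N⁺ : ∀ {X u v} → u ∈ X → adj G u v ≡ true → v ∈ N G X
  ∈N⁺ {X} {u} {v} u∈X uv = lookup⇒[]= v (N G X) (trans (lookup-N X v) (anyIn-true⁺ X _ u∈X uv))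

  ∈N⁻ : ∀ {X v} → v ∈ N G X → ∃ λ u → u ∈ X × adj G u v ≡ true
  ∈N⁻ {X} {v} v∈NX = anyIn-true⁻ X _ (trans (sym (lookup-N X v)) ([]=⇒lookup v∈NX))

  adj-sym-true : ∀ {u v} → adj G u v ≡ true → adj G v u ≡ true
  adj-sym-true {u} {v} uv = trans (adj-sym G v u) uv

  N-mono : ∀ {X Y} → X ⊆ Y → N G X ⊆ N G Y
  N-mono X⊆Y v∈NX = let u , u∈X , uv = ∈N⁻ v∈NX in ∈N⁺ (X⊆Y u∈X) uv

  N-∪ : ∀ {X Y} → N G (X ∪ Y) ⊆ N G X ∪ N G Y
  N-∪ {X} {Y} v∈N[X∪Y] with ∈N⁻ v∈N[X∪Y]
  ... | u , u∈X∪Y , uv with x∈p∪q⁻ X Y u∈X∪Y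
  ...   | inj₁ u∈X = x∈p∪q⁺ (inj₁ (∈N⁺ u∈X uv))
  ...   | inj₂ u∈Y = x∈p∪q⁺ (inj₂ (∈N⁺ u∈Y uv))

  independent? : ∀ S → Dec (Independent G S)
  independent? S = all? λ u → all? λ v →
    (u ∈? S) →-dec ((v ∈? S) →-dec (adj G u v ≟ᵇ false))

  adj⇒≢ : ∀ {u v} → adj G u v ≡ true → u ≢ v
  adj⇒≢ {u} uv refl = case trans (sym uv) (adj-irrefl G u) of λ ()

  Independent-⊆ : ∀ {S T} → T ⊆ S → Independent G S → Independent G T
  Independent-⊆ T⊆S S-independent u v u∈T v∈T = S-independent u v (T⊆S u∈T) (T⊆S v∈T)

  nonadjacent : ∀ {S u v} → Independent G S → u ∈ S → v ∈ S → adj G u v ≢ true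
  nonadjacent {u = u} {v} S-independent u∈S v∈S uv =
    case trans (sym uv) (S-independent u v u∈S v∈S) of λ ()

  N-disjoint : ∀ {S X v} → Independent G S → X ⊆ S → v ∈ N G X → v ∉ S
  N-disjoint S-independent X⊆S v∈NX v∈S =
    let u , u∈X , uv = ∈N⁻ v∈NX in nonadjacent S-independent (X⊆S u∈X) v∈S uv

  MaxIndep-exists : ∃ (MaxIndep G)
  MaxIndep-exists with argmax independent? ∣_∣
  ... | inj₁ none              = contradiction (λ u v u∈∅ _ → ⊥-elim (∉⊥ u∈∅)) (none ∅)
  ... | inj₂ (S , S-independent , S-maximum) = S , S-independent , S-maximum

  neighbour-of-InCore⇒¬InCorona : ∀ {u v} → adj G u v ≡ true → InCore G v → ¬ InCorona G u
  neighbour-of-InCore⇒¬InCorona uv v∈core (S , S-maximum , u∈S) =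
    nonadjacent (proj₁ S-maximum) u∈S (v∈core S S-maximum) uv

  nonadjacent-outside-N : ∀ {I J y x} → Independent G I → y ∈ I ∩ ∁ (N G J) → x ∈ I ∪ J →
                          adj G y x ≢ true
  nonadjacent-outside-N {I} {J} I-independent y∈ x∈I∪J yx with x∈p∩q⁻ I _ y∈ | x∈p∪q⁻ I J x∈I∪J
  ... | y∈I , _  | inj₁ x∈I = nonadjacent I-independent y∈I x∈I yx
  ... | _ , y∉NJ | inj₂ x∈J = x∈∁p⇒x∉p y∉NJ (∈N⁺ x∈J (adj-sym-true yx))

  record MatchingInto (A B : Subset n) : Set where
    field
      partner           : Fin n → Fin n
      partner∈          : ∀ {a} → a ∈ A → partner a ∈ B
      partner-adj       : ∀ {a} → a ∈ A → adj G a (partner a) ≡ true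
      partner-injective : ∀ {a a′} → a ∈ A → a′ ∈ A → partner a ≡ partner a′ → a ≡ a′

  MatchingInto-Empty : ∀ {A B} → Empty A → MatchingInto A B
  MatchingInto-Empty A-empty = record
    { partner           = λ a → a
    ; partner∈          = λ a∈A → ⊥-elim (A-empty (_ , a∈A))
    ; partner-adj       = λ a∈A → ⊥-elim (A-empty (_ , a∈A))
    ; partner-injective = λ a∈A _ _ → ⊥-elim (A-empty (_ , a∈A))
    }

  MatchingInto-⁅⁆ : ∀ {A B a b} → b ∈ B → adj G a b ≡ true → MatchingInto (A ∩ ⁅ a ⁆) (B ∩ ⁅ b ⁆)
  MatchingInto-⁅⁆ {A} {B} {a} {b} b∈B ab = record
    { partner           = λ _ → b
    ; partner∈          = λ _ → x∈p∩q⁺ (b∈B , x∈⁅x⁆ b)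
    ; partner-adj       = λ x∈ → subst (λ x → adj G x b ≡ true) (sym (≡a x∈)) ab
    ; partner-injective = λ x∈ x′∈ _ → trans (≡a x∈) (sym (≡a x′∈))
    }
    where
    ≡a : ∀ {x} → x ∈ A ∩ ⁅ a ⁆ → x ≡ a
    ≡a x∈ = x∈⁅y⁆⇒x≡y a (p∩q⊆q A ⁅ a ⁆ x∈)

  glue : ∀ {A B} T C → MatchingInto (A ∩ T) (B ∩ C) → MatchingInto (A ∩ ∁ T) (B ∩ ∁ C) →
         MatchingInto A B
  glue {A} {B} T C m₁ m₂ = record
    { partner           = λ a → choose a (a ∈? T)
    ; partner∈          = λ {a} a∈A → choose∈ a∈A (a ∈? T)
    ; partner-adj       = λ {a} a∈A → choose-adj a∈A (a ∈? T)
    ; partner-injective = λ {a} {a′} a∈A a′∈A → choose-injective a∈A a′∈A (a ∈? T) (a′ ∈? T)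
    }
    where
    module M₁ = MatchingInto m₁
    module M₂ = MatchingInto m₂

    choose : ∀ a → Dec (a ∈ T) → Fin n
    choose a (yes _) = M₁.partner a
    choose a (no  _) = M₂.partner a

    choose∈ : ∀ {a} → a ∈ A → (a∈?T : Dec (a ∈ T)) → choose a a∈?T ∈ B
    choose∈ a∈A (yes a∈T) = p∩q⊆p B C (M₁.partner∈ (x∈p∩q⁺ (a∈A , a∈T)))
    choose∈ a∈A (no  a∉T) = p∩q⊆p B (∁ C) (M₂.partner∈ (x∈p∩q⁺ (a∈A , x∉p⇒x∈∁p a∉T)))

    choose-adj : ∀ {a} → a ∈ A → (a∈?T : Dec (a ∈ T)) → adj G a (choose a a∈?T) ≡ true
    choose-adj a∈A (yes a∈T) = M₁.partner-adj (x∈p∩q⁺ (a∈A , a∈T))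
    choose-adj a∈A (no  a∉T) = M₂.partner-adj (x∈p∩q⁺ (a∈A , x∉p⇒x∈∁p a∉T))

    sides-disjoint : ∀ {a a′} → a ∈ A → a ∈ T → a′ ∈ A → a′ ∉ T → M₁.partner a ≢ M₂.partner a′
    sides-disjoint a∈A a∈T a′∈A a′∉T eq =
      x∈∁p⇒x∉p (p∩q⊆q B (∁ C) (M₂.partner∈ (x∈p∩q⁺ (a′∈A , x∉p⇒x∈∁p a′∉T))))
               (subst (_∈ C) eq (p∩q⊆q B C (M₁.partner∈ (x∈p∩q⁺ (a∈A , a∈T)))))

    choose-injective : ∀ {a a′} → a ∈ A → a′ ∈ A → (a∈?T : Dec (a ∈ T)) (a′∈?T : Dec (a′ ∈ T)) →
                       choose a a∈?T ≡ choose a′ a′∈?T → a ≡ a′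
    choose-injective a∈A a′∈A (yes a∈T) (yes a′∈T) =
      M₁.partner-injective (x∈p∩q⁺ (a∈A , a∈T)) (x∈p∩q⁺ (a′∈A , a′∈T))
    choose-injective a∈A a′∈A (no a∉T) (no a′∉T) =
      M₂.partner-injective (x∈p∩q⁺ (a∈A , x∉p⇒x∈∁p a∉T)) (x∈p∩q⁺ (a′∈A , x∉p⇒x∈∁p a′∉T))
    choose-injective a∈A a′∈A (yes a∈T) (no a′∉T) eq = contradiction eq (sides-disjoint a∈A a∈T a′∈A a′∉T)
    choose-injective a∈A a′∈A (no a∉T) (yes a′∈T) eq =
      contradiction (sym eq) (sides-disjoint a′∈A a′∈T a∈A a∉T)

  HallCondition : Subset n → Subset n → Set
  HallCondition A B = ∀ T → T ⊆ A → ∣ T ∣ ≤ ∣ B ∩ N G T ∣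

  Tight : Subset n → Subset n → Subset n → Set
  Tight A B T = T ⊆ A × 0 < ∣ T ∣ × ∣ T ∣ < ∣ A ∣ × ∣ B ∩ N G T ∣ ≤ ∣ T ∣

  tight? : ∀ A B T → Dec (Tight A B T)
  tight? A B T = (T ⊆? A) ×-dec (0 <? ∣ T ∣) ×-dec (∣ T ∣ <? ∣ A ∣) ×-dec (∣ B ∩ N G T ∣ ≤? ∣ T ∣)

  HallCondition-∩ : ∀ {A B} T → HallCondition A B → HallCondition (A ∩ T) (B ∩ N G T)
  HallCondition-∩ {A} {B} T hall T′ T′⊆A∩T = begin
    ∣ T′ ∣                  ≤⟨ hall T′ (p∩q⊆p A T ∘ T′⊆A∩T) ⟩
    ∣ B ∩ N G T′ ∣          ≤⟨ p⊆q⇒∣p∣≤∣q∣ shrink ⟩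
    ∣ (B ∩ N G T) ∩ N G T′ ∣ ∎
    where
    shrink : B ∩ N G T′ ⊆ (B ∩ N G T) ∩ N G T′
    shrink x∈ = let x∈B , x∈NT′ = x∈p∩q⁻ B (N G T′) x∈ in
      x∈p∩q⁺ (x∈p∩q⁺ (x∈B , N-mono (p∩q⊆q A T ∘ T′⊆A∩T) x∈NT′) , x∈NT′)

  HallCondition-∩∁ : ∀ {A B T} → HallCondition A B → T ⊆ A → ∣ B ∩ N G T ∣ ≤ ∣ T ∣ →
                     HallCondition (A ∩ ∁ T) (B ∩ ∁ (N G T))
  HallCondition-∩∁ {A} {B} {T} hall T⊆A tight T′ T′⊆A∖T = +-cancelʳ-≤ ∣ T ∣ _ _ (begin
    ∣ T′ ∣ + ∣ T ∣                                 ≡⟨ ∣p∪q∣≡∣p∣+∣q∣ T′ T T′∩T-empty ⟨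
    ∣ T′ ∪ T ∣                                     ≤⟨ hall (T′ ∪ T) T′∪T⊆A ⟩
    ∣ B ∩ N G (T′ ∪ T) ∣                           ≤⟨ p⊆q⇒∣p∣≤∣q∣ split ⟩
    ∣ ((B ∩ ∁ (N G T)) ∩ N G T′) ∪ (B ∩ N G T) ∣     ≤⟨ ∣p∪q∣≤∣p∣+∣q∣ ((B ∩ ∁ (N G T)) ∩ N G T′) (B ∩ N G T) ⟩
    ∣ (B ∩ ∁ (N G T)) ∩ N G T′ ∣ + ∣ B ∩ N G T ∣     ≤⟨ +-monoʳ-≤ _ tight ⟩
    ∣ (B ∩ ∁ (N G T)) ∩ N G T′ ∣ + ∣ T ∣             ∎)
    where
    T′∩T-empty : ∀ {x} → x ∈ T′ → x ∉ T
    T′∩T-empty x∈T′ = x∈∁p⇒x∉p (p∩q⊆q A (∁ T) (T′⊆A∖T x∈T′))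
    T′∪T⊆A : T′ ∪ T ⊆ A
    T′∪T⊆A x∈ with x∈p∪q⁻ T′ T x∈
    ... | inj₁ x∈T′ = p∩q⊆p A (∁ T) (T′⊆A∖T x∈T′)
    ... | inj₂ x∈T  = T⊆A x∈T
    split : B ∩ N G (T′ ∪ T) ⊆ ((B ∩ ∁ (N G T)) ∩ N G T′) ∪ (B ∩ N G T)
    split {x} x∈ with x∈p∩q⁻ B (N G (T′ ∪ T)) x∈ | x ∈? N G T
    ... | x∈B , _        | yes x∈NT = x∈p∪q⁺ (inj₂ (x∈p∩q⁺ (x∈B , x∈NT)))
    ... | x∈B , x∈N[T′∪T] | no  x∉NT with x∈p∪q⁻ (N G T′) (N G T) (N-∪ {T′} {T} x∈N[T′∪T])
    ...   | inj₁ x∈NT′ = x∈p∪q⁺ (inj₁ (x∈p∩q⁺ (x∈p∩q⁺ (x∈B , x∉p⇒x∈∁p x∉NT) , x∈NT′)))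
    ...   | inj₂ x∈NT  = contradiction x∈NT x∉NT

  HallCondition-remove : ∀ {A B a b} → HallCondition A B → ¬ ∃ (Tight A B) → a ∈ A →
                         HallCondition (A ∩ ∁ ⁅ a ⁆) (B ∩ ∁ ⁅ b ⁆)
  HallCondition-remove {A} {B} {a} {b} hall no-tight a∈A T T⊆A-a with nonempty? T
  ... | no  T-empty = subst (_≤ ∣ (B ∩ ∁ ⁅ b ⁆) ∩ N G T ∣) (sym (∣Empty∣≡0 T-empty)) z≤n
  ... | yes (t , t∈T) = ≤-pred (begin
    suc ∣ T ∣                                ≤⟨ ∣T∣<∣B∩NT∣ ⟩
    ∣ B ∩ N G T ∣                            ≤⟨ p⊆q⇒∣p∣≤∣q∣ split ⟩
    ∣ ((B ∩ ∁ ⁅ b ⁆) ∩ N G T) ∪ ⁅ b ⁆ ∣      ≤⟨ ∣p∪q∣≤∣p∣+∣q∣ ((B ∩ ∁ ⁅ b ⁆) ∩ N G T) ⁅ b ⁆ ⟩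
    ∣ (B ∩ ∁ ⁅ b ⁆) ∩ N G T ∣ + ∣ ⁅ b ⁆ ∣    ≡⟨ cong (∣ (B ∩ ∁ ⁅ b ⁆) ∩ N G T ∣ +_) (∣⁅x⁆∣≡1 b) ⟩
    ∣ (B ∩ ∁ ⁅ b ⁆) ∩ N G T ∣ + 1            ≡⟨ +-comm _ 1 ⟩
    suc ∣ (B ∩ ∁ ⁅ b ⁆) ∩ N G T ∣            ∎)
    where
    T⊆A : T ⊆ A
    T⊆A = p∩q⊆p A (∁ ⁅ a ⁆) ∘ T⊆A-a
    ∣T∣<∣A∣ : ∣ T ∣ < ∣ A ∣
    ∣T∣<∣A∣ = ≤-<-trans (p⊆q⇒∣p∣≤∣q∣ T⊆A-a) (x∈p⇒∣p∩∁⁅x⁆∣<∣p∣ a∈A)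
    ∣T∣<∣B∩NT∣ : ∣ T ∣ < ∣ B ∩ N G T ∣
    ∣T∣<∣B∩NT∣ = ≰⇒> λ tight → no-tight (T , T⊆A , x∈p⇒0<∣p∣ t∈T , ∣T∣<∣A∣ , tight)
    split : B ∩ N G T ⊆ ((B ∩ ∁ ⁅ b ⁆) ∩ N G T) ∪ ⁅ b ⁆
    split {x} x∈ with x ≟ b
    ... | yes refl = x∈p∪q⁺ (inj₂ (x∈⁅x⁆ b))
    ... | no  x≢b  = let x∈B , x∈NT = x∈p∩q⁻ B (N G T) x∈ in
      x∈p∪q⁺ (inj₁ (x∈p∩q⁺ (x∈p∧x≢y⇒x∈p∩∁⁅y⁆ x∈B x≢b , x∈NT)))

  hall-neighbour : ∀ {A B a} → HallCondition A B → a ∈ A → ∃ λ b → b ∈ B × adj G a b ≡ true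
  hall-neighbour {A} {B} {a} hall a∈A = b , x∈B , a~b
    where
    ⁅a⁆⊆A : ⁅ a ⁆ ⊆ A
    ⁅a⁆⊆A x∈⁅a⁆ = subst (_∈ A) (sym (x∈⁅y⁆⇒x≡y a x∈⁅a⁆)) a∈A
    found : Nonempty (B ∩ N G ⁅ a ⁆)
    found = 0<∣p∣⇒Nonempty (B ∩ N G ⁅ a ⁆) (subst (_≤ ∣ B ∩ N G ⁅ a ⁆ ∣) (∣⁅x⁆∣≡1 a) (hall ⁅ a ⁆ ⁅a⁆⊆A))
    b = proj₁ found
    x∈B = p∩q⊆p B _ (proj₂ found)
    a~b : adj G a b ≡ true
    a~b = let u , u∈⁅a⁆ , ub = ∈N⁻ (p∩q⊆q B _ (proj₂ found)) in
      subst (λ u → adj G u b ≡ true) (x∈⁅y⁆⇒x≡y a u∈⁅a⁆) ub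

  -- Halmos–Vaughan: split A along a tight proper subset if there is one; otherwise match
  -- any a ∈ A to a neighbour b ∈ B, after which Hall's condition survives removing a and b.
  hall-≤ : ∀ k {A B} → ∣ A ∣ ≤ k → HallCondition A B → MatchingInto A B
  hall-≤ zero {A} ∣A∣≤0 _ = MatchingInto-Empty λ (a , a∈A) → <⇒≱ (x∈p⇒0<∣p∣ a∈A) ∣A∣≤0
  hall-≤ (suc k) {A} {B} ∣A∣≤1+k hall with anySubset? (tight? A B)
  ... | yes (T , T⊆A , 0<∣T∣ , ∣T∣<∣A∣ , tight) =
    glue T (N G T)
      (hall-≤ k {A ∩ T} {B ∩ N G T} (shrink (≤-<-trans (∣p∩q∣≤∣q∣ A T) ∣T∣<∣A∣))
        (HallCondition-∩ {A} {B} T hall))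
      (hall-≤ k {A ∩ ∁ T} {B ∩ ∁ (N G T)} (shrink ∣A∖T∣<∣A∣)
        (HallCondition-∩∁ {A} {B} hall T⊆A tight))
    where
    ∣A∖T∣<∣A∣ : ∣ A ∩ ∁ T ∣ < ∣ A ∣
    ∣A∖T∣<∣A∣ = let t , t∈T = 0<∣p∣⇒Nonempty T 0<∣T∣ in x∈p∩q⇒∣p∩∁q∣<∣p∣ (x∈p∩q⁺ (T⊆A t∈T , t∈T))
    shrink : ∀ {m} → m < ∣ A ∣ → m ≤ k
    shrink m<∣A∣ = ≤-pred (≤-trans m<∣A∣ ∣A∣≤1+k)
  ... | no no-tight with nonempty? A
  ...   | no  A-empty    = MatchingInto-Empty A-empty
  ...   | yes (a , a∈A) =
    let b , b∈B , a~b = hall-neighbour hall a∈A in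
    glue ⁅ a ⁆ ⁅ b ⁆ (MatchingInto-⁅⁆ b∈B a~b)
      (hall-≤ k {A ∩ ∁ ⁅ a ⁆} {B ∩ ∁ ⁅ b ⁆} (≤-pred (≤-trans (x∈p⇒∣p∩∁⁅x⁆∣<∣p∣ a∈A) ∣A∣≤1+k))
        (HallCondition-remove {A} {B} {a} {b} hall no-tight a∈A))

  hall : ∀ {A B} → HallCondition A B → MatchingInto A B
  hall {A} = hall-≤ ∣ A ∣ ≤-refl

-- Matchings as lists of edges

Incident : ∀ {n} → Fin n → Fin n × Fin n → Set
Incident v e = proj₁ e ≡ v ⊎ proj₂ e ≡ v

Joins : ∀ {n} → Fin n → Fin n → Fin n × Fin n → Set
Joins v w e = (proj₁ e ≡ v × proj₂ e ≡ w) ⊎ (proj₂ e ≡ v × proj₁ e ≡ w)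

joins? : ∀ {n} (v w : Fin n) e → Dec (Joins v w e)
joins? v w (x , y) = ((x ≟ v) ×-dec (y ≟ w)) ⊎-dec ((y ≟ v) ×-dec (x ≟ w))

Matched : ∀ {n} → List (Fin n × Fin n) → Fin n → Fin n → Set
Matched M v w = Any (Joins v w) M

Joins⇒Incident : ∀ {n} {v w : Fin n} {e} → Joins v w e → Incident v e
Joins⇒Incident (inj₁ (x≡v , _)) = inj₁ x≡v
Joins⇒Incident (inj₂ (y≡v , _)) = inj₂ y≡v

Joins-sym : ∀ {n} {v w : Fin n} {e} → Joins v w e → Joins w v e
Joins-sym (inj₁ (x≡v , y≡w)) = inj₂ (y≡w , x≡v)
Joins-sym (inj₂ (y≡v , x≡w)) = inj₁ (x≡w , y≡v)

Joins-functional : ∀ {n} {v w w′ : Fin n} {e} → Joins v w e → Joins v w′ e → w ≡ w′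
Joins-functional (inj₁ (_ , y≡w))   (inj₁ (_ , y≡w′))   = trans (sym y≡w) y≡w′
Joins-functional (inj₂ (_ , x≡w))   (inj₂ (_ , x≡w′))   = trans (sym x≡w) x≡w′
Joins-functional (inj₁ (x≡v , y≡w)) (inj₂ (y≡v , x≡w′)) =
  trans (sym y≡w) (trans y≡v (trans (sym x≡v) x≡w′))
Joins-functional (inj₂ (y≡v , x≡w)) (inj₁ (x≡v , y≡w′)) =
  trans (sym x≡w) (trans x≡v (trans (sym y≡v) y≡w′))

Matched-sym : ∀ {n} {M : List (Fin n × Fin n)} {v w} → Matched M v w → Matched M w v
Matched-sym = Any.map Joins-sym

mate : ∀ {n} → List (Fin n × Fin n) → Fin n → Fin n
mate []            v = v
mate ((x , y) ∷ M) v with x ≟ v | y ≟ v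
... | yes _ | _     = y
... | no  _ | yes _ = x
... | no  _ | no  _ = mate M v

MapsTo-mate : ∀ {n} (M : List (Fin n × Fin n)) v → MapsTo M v (mate M v)
MapsTo-mate []            v = inj₂ ((λ ()) , refl)
MapsTo-mate ((x , y) ∷ M) v with x ≟ v | y ≟ v
... | yes x≡v | _        = inj₁ (Any.here (inj₁ (x≡v , refl)))
... | no  _   | yes y≡v  = inj₁ (Any.here (inj₂ (y≡v , refl)))
... | no  x≢v | no  y≢v with MapsTo-mate M v
...   | inj₁ matched          = inj₁ (Any.there matched)
...   | inj₂ (uncovered , eq) = inj₂ (uncovered′ , eq)
  where
  uncovered′ : ¬ Covered ((x , y) ∷ M) v
  uncovered′ (Any.here (inj₁ x≡v)) = x≢v x≡v
  uncovered′ (Any.here (inj₂ y≡v)) = y≢v y≡v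
  uncovered′ (Any.there covered)   = uncovered covered

module _ {n : ℕ} (G : Graph n) where

  DisjointEdges⇒¬Incident : ∀ {e f v} → DisjointEdges G e f → Incident v e → Incident v f → ⊥
  DisjointEdges⇒¬Incident (d₁₁ , _ , _ , _) (inj₁ x≡v) (inj₁ x′≡v) = d₁₁ (trans x≡v (sym x′≡v))
  DisjointEdges⇒¬Incident (_ , d₁₂ , _ , _) (inj₁ x≡v) (inj₂ y′≡v) = d₁₂ (trans x≡v (sym y′≡v))
  DisjointEdges⇒¬Incident (_ , _ , d₂₁ , _) (inj₂ y≡v) (inj₁ x′≡v) = d₂₁ (trans y≡v (sym x′≡v))
  DisjointEdges⇒¬Incident (_ , _ , _ , d₂₂) (inj₂ y≡v) (inj₂ y′≡v) = d₂₂ (trans y≡v (sym y′≡v))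

  Matched-functional : ∀ {M v w w′} → AllPairs (DisjointEdges G) M →
                       Matched M v w → Matched M v w′ → w ≡ w′
  Matched-functional (_  ∷ _)  (Any.here j)  (Any.here j′)  = Joins-functional j j′
  Matched-functional (ds ∷ _)  (Any.here j)  (Any.there m′) =
    All.lookupWith (λ d j′ → ⊥-elim (DisjointEdges⇒¬Incident d (Joins⇒Incident j) (Joins⇒Incident j′)))
                   ds m′
  Matched-functional (ds ∷ _)  (Any.there m) (Any.here j′)  =
    All.lookupWith (λ d j → ⊥-elim (DisjointEdges⇒¬Incident d (Joins⇒Incident j′) (Joins⇒Incident j)))
                   ds m
  Matched-functional (_  ∷ dM) (Any.there m) (Any.there m′) = Matched-functional dM m m′

  MapsTo-functional : ∀ {M v w w′} → AllPairs (DisjointEdges G) M →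
                      MapsTo M v w → MapsTo M v w′ → w ≡ w′
  MapsTo-functional dM (inj₁ m)            (inj₁ m′)            = Matched-functional dM m m′
  MapsTo-functional dM (inj₂ (_ , w≡v))    (inj₂ (_ , w′≡v))    = trans w≡v (sym w′≡v)
  MapsTo-functional dM (inj₁ m)            (inj₂ (uncov , _))   = ⊥-elim (uncov (Any.map Joins⇒Incident m))
  MapsTo-functional dM (inj₂ (uncov , _))  (inj₁ m′)            = ⊥-elim (uncov (Any.map Joins⇒Incident m′))

  MapsTo⇒≡mate : ∀ {M v w} → AllPairs (DisjointEdges G) M → MapsTo M v w → w ≡ mate M v
  MapsTo⇒≡mate {M} {v} dM v↦w = MapsTo-functional dM v↦w (MapsTo-mate M v)

  Matched-adj : ∀ {X M v w} → IsMatchingIn G X M → Matched M v w → adj G v w ≡ true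
  Matched-adj (M-edges , _) m = All.lookupWith (λ (xy , _) j → joined xy j) M-edges m
    where
    joined : ∀ {e v w} → adj G (proj₁ e) (proj₂ e) ≡ true → Joins v w e → adj G v w ≡ true
    joined xy (inj₁ (refl , refl)) = xy
    joined xy (inj₂ (refl , refl)) = adj-sym-true G xy

  edges : ∀ {A B} → MatchingInto G A B → List (Fin n × Fin n)
  edges {A} m = map (λ a → a , MatchingInto.partner m a) (elements A)

  length-edges : ∀ {A B} (m : MatchingInto G A B) → length (edges m) ≡ ∣ A ∣
  length-edges {A} m = trans (length-map _ (elements A)) (length-elements A)

  edges-IsMatchingIn : ∀ {A B X} (m : MatchingInto G A B) → (∀ {x} → x ∈ A → x ∉ B) →
                       A ⊆ X → B ⊆ X → IsMatchingIn G X (edges m)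
  edges-IsMatchingIn {A} {B} m A∩B-empty A⊆X B⊆X =
    All.map⁺ (All.map (λ a∈A → partner-adj a∈A , A⊆X a∈A , B⊆X (partner∈ a∈A)) (elements⊆ A)) ,
    AllPairs.map⁺ (AllPairs-map-within disjoint (elements⊆ A) (elements-unique A))
    where
    open MatchingInto m
    disjoint : ∀ {a a′} → a ∈ A → a′ ∈ A → a ≢ a′ → DisjointEdges G (a , partner a) (a′ , partner a′)
    disjoint a∈A a′∈A a≢a′ =
      a≢a′ ,
      (λ a≡pa′ → A∩B-empty a∈A (subst (_∈ B) (sym a≡pa′) (partner∈ a′∈A))) ,
      (λ pa≡a′ → A∩B-empty a′∈A (subst (_∈ B) pa≡a′ (partner∈ a∈A))) ,
      a≢a′ ∘ partner-injective a∈A a′∈A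

  length≤∣cover∣ : ∀ {M} (C : Subset n) → AllPairs (DisjointEdges G) M →
                   All (λ e → proj₁ e ∈ C ⊎ proj₂ e ∈ C) M → length M ≤ ∣ C ∣
  length≤∣cover∣ {M} C disjoint covered = begin
    length M            ≡⟨ length-map end M ⟨
    length (map end M)  ≤⟨ Unique⇒length≤∣p∣ C (All.map⁺ (All.map end∈C covered)) ends-unique ⟩
    ∣ C ∣               ∎
    where
    end : Fin n × Fin n → Fin n
    end (x , y) = if does (x ∈? C) then x else y

    end-Incident : ∀ e → Incident (end e) e
    end-Incident (x , y) with x ∈? C
    ... | yes _ = inj₁ refl
    ... | no  _ = inj₂ refl

    end∈C : ∀ {e} → proj₁ e ∈ C ⊎ proj₂ e ∈ C → end e ∈ C
    end∈C {x , y} x∈C⊎y∈C with x ∈? C | x∈C⊎y∈C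
    ... | yes x∈C | _         = x∈C
    ... | no  x∉C | inj₁ x∈C  = contradiction x∈C x∉C
    ... | no  _   | inj₂ y∈C  = y∈C

    ends-unique : Unique (map end M)
    ends-unique = AllPairs.map⁺ (AllPairs.map (λ {e} {f} d eq →
      DisjointEdges⇒¬Incident d (end-Incident e) (subst (λ v → Incident v f) (sym eq) (end-Incident f)))
      disjoint)

-- Critical independent sets

-- Uncrossing: Y collects the vertices of I ∪ J without neighbours in the other set.
-- The two counting inequalities say that the surpluses of I ∩ J and Y together are
-- at least those of I and J together.
module Uncrossing {n : ℕ} (G : Graph n) {I J : Subset n}
                  (I-independent : Independent G I) (J-independent : Independent G J) where

  X Y Z : Subset n
  X = I ∩ J
  Y = (I ∩ ∁ (N G J)) ∪ (J ∩ ∁ (N G I))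
  Z = (I ∩ N G J) ∪ (J ∩ N G I)

  private
    side⊆I∪J : ∀ {P Q} → (I ∩ P) ∪ (J ∩ Q) ⊆ I ∪ J
    side⊆I∪J {P} {Q} x∈ with x∈p∪q⁻ (I ∩ P) (J ∩ Q) x∈
    ... | inj₁ x∈I∩P = x∈p∪q⁺ (inj₁ (p∩q⊆p I P x∈I∩P))
    ... | inj₂ x∈J∩Q = x∈p∪q⁺ (inj₂ (p∩q⊆p J Q x∈J∩Q))

    Y-nonadjacent : ∀ {y x} → y ∈ Y → x ∈ I ∪ J → adj G y x ≢ true
    Y-nonadjacent {x = x} y∈Y x∈I∪J with x∈p∪q⁻ (I ∩ ∁ (N G J)) _ y∈Y
    ... | inj₁ y∈I∖NJ = nonadjacent-outside-N G I-independent y∈I∖NJ x∈I∪J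
    ... | inj₂ y∈J∖NI = nonadjacent-outside-N G J-independent y∈J∖NI (subst (x ∈_) (∪-comm I J) x∈I∪J)

    I∪J⊆Y∪Z : I ∪ J ⊆ Y ∪ Z
    I∪J⊆Y∪Z {x} x∈ with x∈p∪q⁻ I J x∈ | x ∈? N G J | x ∈? N G I
    ... | inj₁ x∈I | yes x∈NJ | _        = q⊆p∪q Y Z (x∈p∪q⁺ (inj₁ (x∈p∩q⁺ (x∈I , x∈NJ))))
    ... | inj₁ x∈I | no  x∉NJ | _        = p⊆p∪q Z (x∈p∪q⁺ (inj₁ (x∈p∩q⁺ (x∈I , x∉p⇒x∈∁p x∉NJ))))
    ... | inj₂ x∈J | _        | yes x∈NI = q⊆p∪q Y Z (x∈p∪q⁺ (inj₂ (x∈p∩q⁺ (x∈J , x∈NI))))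
    ... | inj₂ x∈J | _        | no  x∉NI = p⊆p∪q Z (x∈p∪q⁺ (inj₂ (x∈p∩q⁺ (x∈J , x∉p⇒x∈∁p x∉NI))))

    NY∪Z⊆NI∪NJ : N G Y ∪ Z ⊆ N G I ∪ N G J
    NY∪Z⊆NI∪NJ x∈ with x∈p∪q⁻ (N G Y) Z x∈
    ... | inj₁ x∈NY = N-∪ G {I} {J} (N-mono G side⊆I∪J x∈NY)
    ... | inj₂ x∈Z  with x∈p∪q⁻ (I ∩ N G J) (J ∩ N G I) x∈Z
    ...   | inj₁ x∈I∩NJ = q⊆p∪q (N G I) (N G J) (p∩q⊆q I _ x∈I∩NJ)
    ...   | inj₂ x∈J∩NI = p⊆p∪q (N G J) (p∩q⊆q J _ x∈J∩NI)

    NX⊆NI∩NJ : N G X ⊆ N G I ∩ N G J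
    NX⊆NI∩NJ x∈ = x∈p∩q⁺ (N-mono G (p∩q⊆p I J) x∈ , N-mono G (p∩q⊆q I J) x∈)

    NY∩Z-empty : ∀ {x} → x ∈ N G Y → x ∉ Z
    NY∩Z-empty x∈NY x∈Z = let y , y∈Y , yx = ∈N⁻ G x∈NY in
      Y-nonadjacent y∈Y (side⊆I∪J x∈Z) yx

  Y-independent : Independent G Y
  Y-independent u v u∈Y v∈Y = ¬-not (Y-nonadjacent u∈Y (side⊆I∪J v∈Y))

  ∣I∣+∣J∣≤∣X∣+∣Y∣+∣Z∣ : ∣ I ∣ + ∣ J ∣ ≤ ∣ X ∣ + (∣ Y ∣ + ∣ Z ∣)
  ∣I∣+∣J∣≤∣X∣+∣Y∣+∣Z∣ = begin
    ∣ I ∣ + ∣ J ∣              ≡⟨ ∣p∪q∣+∣p∩q∣≡∣p∣+∣q∣ I J ⟨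
    ∣ I ∪ J ∣ + ∣ X ∣          ≡⟨ +-comm (∣ I ∪ J ∣) (∣ X ∣) ⟩
    ∣ X ∣ + ∣ I ∪ J ∣          ≤⟨ +-monoʳ-≤ (∣ X ∣) (≤-trans (p⊆q⇒∣p∣≤∣q∣ I∪J⊆Y∪Z) (∣p∪q∣≤∣p∣+∣q∣ Y Z)) ⟩
    ∣ X ∣ + (∣ Y ∣ + ∣ Z ∣)    ∎

  ∣NX∣+∣NY∣+∣Z∣≤∣NI∣+∣NJ∣ : ∣ N G X ∣ + (∣ N G Y ∣ + ∣ Z ∣) ≤ ∣ N G I ∣ + ∣ N G J ∣
  ∣NX∣+∣NY∣+∣Z∣≤∣NI∣+∣NJ∣ = begin
    ∣ N G X ∣ + (∣ N G Y ∣ + ∣ Z ∣)        ≡⟨ cong (∣ N G X ∣ +_) (∣p∪q∣≡∣p∣+∣q∣ (N G Y) Z NY∩Z-empty) ⟨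
    ∣ N G X ∣ + ∣ N G Y ∪ Z ∣              ≤⟨ +-mono-≤ (p⊆q⇒∣p∣≤∣q∣ NX⊆NI∩NJ) (p⊆q⇒∣p∣≤∣q∣ NY∪Z⊆NI∪NJ) ⟩
    ∣ N G I ∩ N G J ∣ + ∣ N G I ∪ N G J ∣  ≡⟨ +-comm (∣ N G I ∩ N G J ∣) _ ⟩
    ∣ N G I ∪ N G J ∣ + ∣ N G I ∩ N G J ∣  ≡⟨ ∣p∪q∣+∣p∩q∣≡∣p∣+∣q∣ (N G I) (N G J) ⟩
    ∣ N G I ∣ + ∣ N G J ∣                  ∎

-- `j + ni ≤ i + nj` encodes j - nj ≤ i - ni, i.e. a comparison of surpluses |X| - |N(X)|
-- written without subtraction, as in `Critical`.
surplus-trans : ∀ {j nj i ni a na} → j + ni ≤ i + nj → i + na ≤ a + ni → j + na ≤ a + nj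
surplus-trans {j} {nj} {i} {ni} {a} {na} j≼i i≼a = +-cancelʳ-≤ (i + ni) (j + na) (a + nj) (begin
  (j + na) + (i + ni)  ≡⟨ swap j na i ni ⟩
  (j + ni) + (i + na)  ≤⟨ +-mono-≤ j≼i i≼a ⟩
  (i + nj) + (a + ni)  ≡⟨ swap′ i nj a ni ⟩
  (a + nj) + (i + ni)  ∎)
  where
  swap : ∀ p q r s → (p + q) + (r + s) ≡ (p + s) + (r + q)
  swap = solve-∀
  swap′ : ∀ p q r s → (p + q) + (r + s) ≡ (r + q) + (p + s)
  swap′ = solve-∀

module _ {n : ℕ} (G : Graph n) where

  surplus≥⇒Critical : ∀ {I A} → Critical G I → Independent G A →
                      ∣ I ∣ + ∣ N G A ∣ ≤ ∣ A ∣ + ∣ N G I ∣ → Critical G A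
  surplus≥⇒Critical {I} {A} (_ , I-critical) A-independent I≼A =
    A-independent , λ J J-independent →
      surplus-trans {∣ J ∣} {∣ N G J ∣} {∣ I ∣} {∣ N G I ∣} {∣ A ∣} {∣ N G A ∣}
                    (I-critical J J-independent) I≼A

  -- Compare I with I′ = I − N(T): the vertices lost are I ∩ N(T), while N(I′) misses all of T.
  Critical⇒HallCondition : ∀ {I} → Critical G I → HallCondition G (N G I) I
  Critical⇒HallCondition {I} (I-independent , I-critical) T T⊆NI =
    +-cancelˡ-≤ i′ t (∣ I ∩ N G T ∣) (+-cancelʳ-≤ r (i′ + t) (i′ + ∣ I ∩ N G T ∣) (begin
      i′ + t + r                ≤⟨ +-monoˡ-≤ r (+-monoʳ-≤ i′ (p⊆q⇒∣p∣≤∣q∣ T⊆NI∩T)) ⟩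
      i′ + ∣ N G I ∩ T ∣ + r    ≡⟨ +-assoc i′ (∣ N G I ∩ T ∣) r ⟩
      i′ + (∣ N G I ∩ T ∣ + r)  ≡⟨ cong (i′ +_) (∣p∣≡∣p∩q∣+∣p∩∁q∣ (N G I) T) ⟨
      i′ + ∣ N G I ∣            ≤⟨ I-critical I′ (Independent-⊆ G (p∩q⊆p I _) I-independent) ⟩
      ∣ I ∣ + ∣ N G I′ ∣        ≤⟨ +-monoʳ-≤ (∣ I ∣) (p⊆q⇒∣p∣≤∣q∣ NI′⊆NI∖T) ⟩
      ∣ I ∣ + r                 ≡⟨ cong (_+ r) (∣p∣≡∣p∩q∣+∣p∩∁q∣ I (N G T)) ⟩
      ∣ I ∩ N G T ∣ + i′ + r    ≡⟨ cong (_+ r) (+-comm (∣ I ∩ N G T ∣) i′) ⟩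
      i′ + ∣ I ∩ N G T ∣ + r    ∎))
    where
    I′ : Subset n
    I′ = I ∩ ∁ (N G T)
    i′ t r : ℕ
    i′ = ∣ I′ ∣
    t  = ∣ T ∣
    r  = ∣ N G I ∩ ∁ T ∣
    T⊆NI∩T : T ⊆ N G I ∩ T
    T⊆NI∩T x∈T = x∈p∩q⁺ (T⊆NI x∈T , x∈T)
    NI′⊆NI∖T : N G I′ ⊆ N G I ∩ ∁ T
    NI′⊆NI∖T {x} x∈NI′ with ∈N⁻ G x∈NI′
    ... | u , u∈I′ , ux = x∈p∩q⁺ (∈N⁺ G (p∩q⊆p I _ u∈I′) ux , x∉p⇒x∈∁p λ x∈T →
          x∈∁p⇒x∉p (p∩q⊆q I _ u∈I′) (∈N⁺ G x∈T (adj-sym-true G ux)))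

  Critical-∩ : ∀ {I J} → Critical G I → Critical G J → Critical G (I ∩ J)
  Critical-∩ {I} {J} I-critical@(I-independent , _) (J-independent , J-critical) =
    surplus≥⇒Critical I-critical (Independent-⊆ G (p∩q⊆p I J) I-independent)
      (+-cancelʳ-≤ (j + (ny + z)) (i + nx) (x + ni) (begin
        (i + nx) + (j + (ny + z))  ≡⟨ interchange i nx j (ny + z) ⟩
        (i + j) + (nx + (ny + z))  ≤⟨ +-mono-≤ ∣I∣+∣J∣≤∣X∣+∣Y∣+∣Z∣ ∣NX∣+∣NY∣+∣Z∣≤∣NI∣+∣NJ∣ ⟩
        (x + (y + z)) + (ni + nj)  ≡⟨ regroup x y z ni nj ⟩
        (x + ni) + ((y + nj) + z)  ≤⟨ +-monoʳ-≤ (x + ni) (+-monoˡ-≤ z (J-critical Y Y-independent)) ⟩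
        (x + ni) + ((j + ny) + z)  ≡⟨ cong ((x + ni) +_) (+-assoc j ny z) ⟩
        (x + ni) + (j + (ny + z))  ∎))
    where
    open Uncrossing G I-independent J-independent
    i j x y z ni nj nx ny : ℕ
    i  = ∣ I ∣
    j  = ∣ J ∣
    x  = ∣ X ∣
    y  = ∣ Y ∣
    z  = ∣ Z ∣
    ni = ∣ N G I ∣
    nj = ∣ N G J ∣
    nx = ∣ N G X ∣
    ny = ∣ N G Y ∣
    interchange : ∀ a b c d → (a + b) + (c + d) ≡ (a + c) + (b + d)
    interchange = solve-∀
    regroup : ∀ x y z ni nj → (x + (y + z)) + (ni + nj) ≡ (x + ni) + ((y + nj) + z)
    regroup = solve-∀

module Decomposition {n : ℕ} (G : Graph n) {I : Subset n} (I-critical : Critical G I)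
                     (m : MatchingInto G (N G I) I) where

  open MatchingInto m

  private
    L Lc NI : Subset n
    L  = Lset G I
    Lc = Lcset G I
    NI = N G I

    I-independent : Independent G I
    I-independent = proj₁ I-critical

  partner∈I∖S : ∀ {S t} → Independent G S → t ∈ S ∩ NI → partner t ∈ I ∩ ∁ S
  partner∈I∖S {S} S-independent t∈S∩NI =
    let t∈S , t∈NI = x∈p∩q⁻ S NI t∈S∩NI in
    x∈p∩q⁺ (partner∈ t∈NI , x∉p⇒x∈∁p λ pt∈S → nonadjacent G S-independent t∈S pt∈S (partner-adj t∈NI))

  partner-injective-on : ∀ {S} {t t′} → t ∈ S ∩ NI → t′ ∈ S ∩ NI → partner t ≡ partner t′ → t ≡ t′
  partner-injective-on {S} t∈ t′∈ = partner-injective (p∩q⊆q S NI t∈) (p∩q⊆q S NI t′∈)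

  ∣S∣≤∣I∩S∣+∣S∩NI∣+∣S∩Lc∣ : ∀ S → ∣ S ∣ ≤ ∣ I ∩ S ∣ + ∣ S ∩ NI ∣ + ∣ S ∩ Lc ∣
  ∣S∣≤∣I∩S∣+∣S∩NI∣+∣S∩Lc∣ S = begin
    ∣ S ∣                                     ≡⟨ ∣p∣≡∣p∩q∣+∣p∩∁q∣ S L ⟩
    ∣ S ∩ L ∣ + ∣ S ∩ Lc ∣                    ≤⟨ +-monoˡ-≤ (∣ S ∩ Lc ∣) (p⊆q⇒∣p∣≤∣q∣ S∩L⊆) ⟩
    ∣ (I ∩ S) ∪ (S ∩ NI) ∣ + ∣ S ∩ Lc ∣       ≤⟨ +-monoˡ-≤ (∣ S ∩ Lc ∣) (∣p∪q∣≤∣p∣+∣q∣ (I ∩ S) (S ∩ NI)) ⟩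
    ∣ I ∩ S ∣ + ∣ S ∩ NI ∣ + ∣ S ∩ Lc ∣       ∎
    where
    S∩L⊆ : S ∩ L ⊆ (I ∩ S) ∪ (S ∩ NI)
    S∩L⊆ x∈ with x∈p∩q⁻ S L x∈
    ... | x∈S , x∈L with x∈p∪q⁻ I NI x∈L
    ...   | inj₁ x∈I  = x∈p∪q⁺ (inj₁ (x∈p∩q⁺ (x∈I , x∈S)))
    ...   | inj₂ x∈NI = x∈p∪q⁺ (inj₂ (x∈p∩q⁺ (x∈S , x∈NI)))

  Independent⇒∣S∣≤∣I∣+∣S∩Lc∣ : ∀ {S} → Independent G S → ∣ S ∣ ≤ ∣ I ∣ + ∣ S ∩ Lc ∣
  Independent⇒∣S∣≤∣I∣+∣S∩Lc∣ {S} S-independent = begin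
    ∣ S ∣                                  ≤⟨ ∣S∣≤∣I∩S∣+∣S∩NI∣+∣S∩Lc∣ S ⟩
    ∣ I ∩ S ∣ + ∣ S ∩ NI ∣ + ∣ S ∩ Lc ∣    ≤⟨ +-monoˡ-≤ (∣ S ∩ Lc ∣) (+-monoʳ-≤ (∣ I ∩ S ∣) ∣S∩NI∣≤∣I∖S∣) ⟩
    ∣ I ∩ S ∣ + ∣ I ∩ ∁ S ∣ + ∣ S ∩ Lc ∣   ≡⟨ cong (_+ ∣ S ∩ Lc ∣) (∣p∣≡∣p∩q∣+∣p∩∁q∣ I S) ⟨
    ∣ I ∣ + ∣ S ∩ Lc ∣                     ∎
    where
    ∣S∩NI∣≤∣I∖S∣ : ∣ S ∩ NI ∣ ≤ ∣ I ∩ ∁ S ∣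
    ∣S∩NI∣≤∣I∖S∣ = injective⇒∣p∣≤∣q∣ partner (partner∈I∖S S-independent) partner-injective-on

  I-Lc-nonadjacent : ∀ {u v} → u ∈ I → v ∈ Lc → adj G u v ≢ true
  I-Lc-nonadjacent u∈I v∈Lc uv = x∈∁p⇒x∉p v∈Lc (q⊆p∪q I NI (∈N⁺ G u∈I uv))

  I∪B-independent : ∀ {B} → Independent G B → B ⊆ Lc → Independent G (I ∪ B)
  I∪B-independent {B} B-independent B⊆Lc u v u∈ v∈ with x∈p∪q⁻ I B u∈ | x∈p∪q⁻ I B v∈
  ... | inj₁ u∈I | inj₁ v∈I = I-independent u v u∈I v∈I
  ... | inj₁ u∈I | inj₂ v∈B = ¬-not (I-Lc-nonadjacent u∈I (B⊆Lc v∈B))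
  ... | inj₂ u∈B | inj₁ v∈I = ¬-not (I-Lc-nonadjacent v∈I (B⊆Lc u∈B) ∘ adj-sym-true G)
  ... | inj₂ u∈B | inj₂ v∈B = B-independent u v u∈B v∈B

  ∣I∪B∣≡∣I∣+∣B∣ : ∀ {B} → B ⊆ Lc → ∣ I ∪ B ∣ ≡ ∣ I ∣ + ∣ B ∣
  ∣I∪B∣≡∣I∣+∣B∣ {B} B⊆Lc = ∣p∪q∣≡∣p∣+∣q∣ I B λ x∈I x∈B → x∈∁p⇒x∉p (B⊆Lc x∈B) (p⊆p∪q NI x∈I)

  MaxIndep⇒MaxIndepIn-Lc : ∀ {S} → MaxIndep G S → MaxIndepIn G Lc (S ∩ Lc)
  MaxIndep⇒MaxIndepIn-Lc {S} (S-independent , S-maximum) =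
    p∩q⊆q S Lc , Independent-⊆ G (p∩q⊆p S Lc) S-independent , λ T T⊆Lc T-independent →
      +-cancelˡ-≤ (∣ I ∣) (∣ T ∣) (∣ S ∩ Lc ∣) (begin
        ∣ I ∣ + ∣ T ∣       ≡⟨ ∣I∪B∣≡∣I∣+∣B∣ T⊆Lc ⟨
        ∣ I ∪ T ∣           ≤⟨ S-maximum (I ∪ T) (I∪B-independent T-independent T⊆Lc) ⟩
        ∣ S ∣               ≤⟨ Independent⇒∣S∣≤∣I∣+∣S∩Lc∣ S-independent ⟩
        ∣ I ∣ + ∣ S ∩ Lc ∣  ∎)

  MaxIndepIn-Lc⇒MaxIndep : ∀ {B} → MaxIndepIn G Lc B → MaxIndep G (I ∪ B)
  MaxIndepIn-Lc⇒MaxIndep {B} (B⊆Lc , B-independent , B-maximum) =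
    I∪B-independent B-independent B⊆Lc , λ T T-independent → begin
      ∣ T ∣               ≤⟨ Independent⇒∣S∣≤∣I∣+∣S∩Lc∣ T-independent ⟩
      ∣ I ∣ + ∣ T ∩ Lc ∣  ≤⟨ +-monoʳ-≤ (∣ I ∣) (B-maximum (T ∩ Lc) (p∩q⊆q T Lc)
                                                  (Independent-⊆ G (p∩q⊆p T Lc) T-independent)) ⟩
      ∣ I ∣ + ∣ B ∣       ≡⟨ ∣I∪B∣≡∣I∣+∣B∣ B⊆Lc ⟨
      ∣ I ∪ B ∣           ∎

  MaxIndep⇒∣I∣≤∣I∩S∣+∣S∩NI∣ : ∀ {S} → MaxIndep G S → ∣ I ∣ ≤ ∣ I ∩ S ∣ + ∣ S ∩ NI ∣
  MaxIndep⇒∣I∣≤∣I∩S∣+∣S∩NI∣ {S} S-maximum =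
    +-cancelʳ-≤ (∣ S ∩ Lc ∣) (∣ I ∣) (∣ I ∩ S ∣ + ∣ S ∩ NI ∣) (begin
      ∣ I ∣ + ∣ S ∩ Lc ∣                   ≡⟨ ∣I∪B∣≡∣I∣+∣B∣ (p∩q⊆q S Lc) ⟨
      ∣ I ∪ (S ∩ Lc) ∣                     ≤⟨ proj₂ S-maximum _ (proj₁ I∪[S∩Lc]-maximum) ⟩
      ∣ S ∣                                ≤⟨ ∣S∣≤∣I∩S∣+∣S∩NI∣+∣S∩Lc∣ S ⟩
      ∣ I ∩ S ∣ + ∣ S ∩ NI ∣ + ∣ S ∩ Lc ∣  ∎)
    where
    I∪[S∩Lc]-maximum = MaxIndepIn-Lc⇒MaxIndep (MaxIndep⇒MaxIndepIn-Lc S-maximum)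

  InCoreIn-Lc⇒InCore : ∀ {v} → InCoreIn G Lc v → InCore G v
  InCoreIn-Lc⇒InCore v∈core[Lc] S S-maximum =
    p∩q⊆p S Lc (v∈core[Lc] (S ∩ Lc) (MaxIndep⇒MaxIndepIn-Lc S-maximum))

  InCore⇒InCoreIn-Lc : ∀ {v} → InCore G v → v ∈ Lc → InCoreIn G Lc v
  InCore⇒InCoreIn-Lc v∈core v∈Lc B B-maximum
    with x∈p∪q⁻ I B (v∈core (I ∪ B) (MaxIndepIn-Lc⇒MaxIndep B-maximum))
  ... | inj₁ v∈I = contradiction (p⊆p∪q NI v∈I) (x∈∁p⇒x∉p v∈Lc)
  ... | inj₂ v∈B = v∈B

  InCore∩L⊆I : ∀ {v} → InCore G v → v ∈ L → v ∈ I
  InCore∩L⊆I v∈core v∈L with MaxIndep-exists G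
  ... | S , S-maximum
    with x∈p∪q⁻ I (S ∩ Lc) (v∈core _ (MaxIndepIn-Lc⇒MaxIndep (MaxIndep⇒MaxIndepIn-Lc S-maximum)))
  ...   | inj₁ v∈I     = v∈I
  ...   | inj₂ v∈S∩Lc  = contradiction v∈L (x∈∁p⇒x∉p (p∩q⊆q S Lc v∈S∩Lc))

  -- For a maximum independent S, the trace I ∩ S has surplus at least that of I,
  -- so it is itself critical and therefore contains ker(G).
  InKer⇒InCore : ∀ {v} → InKer G v → InCore G v
  InKer⇒InCore v∈ker S S-maximum@(S-independent , _) =
    p∩q⊆q I S (v∈ker A (surplus≥⇒Critical G I-critical (Independent-⊆ G (p∩q⊆p I S) I-independent) I≼A))
    where
    A : Subset n
    A = I ∩ S
    NA∩S-empty : ∀ {x} → x ∈ N G A → x ∉ S ∩ NI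
    NA∩S-empty x∈NA x∈S∩NI = N-disjoint G S-independent (p∩q⊆q I S) x∈NA (p∩q⊆p S NI x∈S∩NI)
    NA∪[S∩NI]⊆NI : N G A ∪ (S ∩ NI) ⊆ NI
    NA∪[S∩NI]⊆NI x∈ with x∈p∪q⁻ (N G A) (S ∩ NI) x∈
    ... | inj₁ x∈NA    = N-mono G (p∩q⊆p I S) x∈NA
    ... | inj₂ x∈S∩NI  = p∩q⊆q S NI x∈S∩NI
    I≼A : ∣ I ∣ + ∣ N G A ∣ ≤ ∣ A ∣ + ∣ NI ∣
    I≼A = begin
      ∣ I ∣ + ∣ N G A ∣                      ≤⟨ +-monoˡ-≤ (∣ N G A ∣) (MaxIndep⇒∣I∣≤∣I∩S∣+∣S∩NI∣ S-maximum) ⟩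
      ∣ A ∣ + ∣ S ∩ NI ∣ + ∣ N G A ∣         ≡⟨ +-assoc (∣ A ∣) (∣ S ∩ NI ∣) (∣ N G A ∣) ⟩
      ∣ A ∣ + (∣ S ∩ NI ∣ + ∣ N G A ∣)       ≡⟨ cong (∣ A ∣ +_) (+-comm (∣ S ∩ NI ∣) (∣ N G A ∣)) ⟩
      ∣ A ∣ + (∣ N G A ∣ + ∣ S ∩ NI ∣)       ≡⟨ cong (∣ A ∣ +_) (∣p∪q∣≡∣p∣+∣q∣ (N G A) (S ∩ NI) NA∩S-empty) ⟨
      ∣ A ∣ + ∣ N G A ∪ (S ∩ NI) ∣           ≤⟨ +-monoʳ-≤ (∣ A ∣) (p⊆q⇒∣p∣≤∣q∣ NA∪[S∩NI]⊆NI) ⟩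
      ∣ A ∣ + ∣ NI ∣                         ∎

  partner-InCore : ∀ {u} → u ∈ NI → ¬ InCorona G u → InCore G (partner u)
  partner-InCore {u} u∈NI u∉corona S S-maximum@(S-independent , _) with partner u ∈? S
  ... | yes pu∈S = pu∈S
  ... | no  pu∉S = contradiction (begin-strict
    ∣ I ∣                        ≤⟨ MaxIndep⇒∣I∣≤∣I∩S∣+∣S∩NI∣ S-maximum ⟩
    ∣ I ∩ S ∣ + ∣ S ∩ NI ∣       <⟨ +-monoʳ-< (∣ I ∩ S ∣) ∣S∩NI∣<∣I∖S∣ ⟩
    ∣ I ∩ S ∣ + ∣ I ∩ ∁ S ∣      ≡⟨ ∣p∣≡∣p∩q∣+∣p∩∁q∣ I S ⟨
    ∣ I ∣                        ∎) (<-irrefl refl)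
    where
    pu∈I∖S : partner u ∈ I ∩ ∁ S
    pu∈I∖S = x∈p∩q⁺ (partner∈ u∈NI , x∉p⇒x∈∁p pu∉S)
    image⊆ : ∀ {t} → t ∈ S ∩ NI → partner t ∈ (I ∩ ∁ S) ∩ ∁ ⁅ partner u ⁆
    image⊆ t∈S∩NI = x∈p∧x≢y⇒x∈p∩∁⁅y⁆ (partner∈I∖S S-independent t∈S∩NI) λ pt≡pu →
      u∉corona (S , S-maximum , subst (_∈ S) (partner-injective (p∩q⊆q S NI t∈S∩NI) u∈NI pt≡pu)
                                              (p∩q⊆p S NI t∈S∩NI))
    ∣S∩NI∣<∣I∖S∣ : ∣ S ∩ NI ∣ < ∣ I ∩ ∁ S ∣
    ∣S∩NI∣<∣I∖S∣ = ≤-<-trans (injective⇒∣p∣≤∣q∣ partner image⊆ partner-injective-on)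
                             (x∈p⇒∣p∩∁⁅x⁆∣<∣p∣ pu∈I∖S)

  unmatched⇒∣NI∖NJ∣<∣I∖J∣ : ∀ {J v} → v ∈ I ∩ ∁ J → (∀ {u} → u ∈ NI → partner u ≢ v) →
                             ∣ NI ∩ ∁ (N G J) ∣ < ∣ I ∩ ∁ J ∣
  unmatched⇒∣NI∖NJ∣<∣I∖J∣ {J} {v} v∈I∖J unmatched =
    ≤-<-trans (injective⇒∣p∣≤∣q∣ partner image⊆ λ u∈ u′∈ → partner-injective (p∩q⊆p NI _ u∈) (p∩q⊆p NI _ u′∈))
              (x∈p⇒∣p∩∁⁅x⁆∣<∣p∣ v∈I∖J)
    where
    image⊆ : ∀ {u} → u ∈ NI ∩ ∁ (N G J) → partner u ∈ (I ∩ ∁ J) ∩ ∁ ⁅ v ⁆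
    image⊆ u∈ = let u∈NI , u∉NJ = x∈p∩q⁻ NI _ u∈ in
      x∈p∧x≢y⇒x∈p∩∁⁅y⁆
        (x∈p∩q⁺ (partner∈ u∈NI , x∉p⇒x∈∁p λ pu∈J →
          x∈∁p⇒x∉p u∉NJ (∈N⁺ G pu∈J (adj-sym-true G (partner-adj u∈NI)))))
        (unmatched u∈NI)

  -- J′ = I ∩ J is critical, but if v ∉ J then N(I) − N(J′) injects into (I − J′) − v,
  -- which gives I a strictly larger surplus than J′.
  unmatched⇒InKer : ∀ {v} → v ∈ I → (∀ {u} → u ∈ NI → partner u ≢ v) → InKer G v
  unmatched⇒InKer {v} v∈I unmatched J J-critical with v ∈? J
  ... | yes v∈J = v∈J
  ... | no  v∉J = contradiction (begin-strict
    ∣ J′ ∣ + (∣ N G J′ ∣ + ∣ D ∣)          <⟨ +-monoʳ-< (∣ J′ ∣) (+-monoʳ-< (∣ N G J′ ∣) ∣D∣<∣I∖J′∣) ⟩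
    ∣ J′ ∣ + (∣ N G J′ ∣ + ∣ I ∩ ∁ J′ ∣)   ≡⟨ swap (∣ J′ ∣) (∣ N G J′ ∣) (∣ I ∩ ∁ J′ ∣) ⟩
    ∣ J′ ∣ + ∣ I ∩ ∁ J′ ∣ + ∣ N G J′ ∣     ≤⟨ +-monoˡ-≤ (∣ N G J′ ∣) (+-monoˡ-≤ (∣ I ∩ ∁ J′ ∣) ∣J′∣≤∣I∩J′∣) ⟩
    ∣ I ∩ J′ ∣ + ∣ I ∩ ∁ J′ ∣ + ∣ N G J′ ∣ ≡⟨ cong (_+ ∣ N G J′ ∣) (∣p∣≡∣p∩q∣+∣p∩∁q∣ I J′) ⟨
    ∣ I ∣ + ∣ N G J′ ∣                     ≤⟨ proj₂ (Critical-∩ G I-critical J-critical) I I-independent ⟩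
    ∣ J′ ∣ + ∣ NI ∣                        ≤⟨ +-monoʳ-≤ (∣ J′ ∣) ∣NI∣≤∣NJ′∣+∣D∣ ⟩
    ∣ J′ ∣ + (∣ N G J′ ∣ + ∣ D ∣)          ∎) (<-irrefl refl)
    where
    J′ D : Subset n
    J′ = I ∩ J
    D  = NI ∩ ∁ (N G J′)
    ∣D∣<∣I∖J′∣ : ∣ D ∣ < ∣ I ∩ ∁ J′ ∣
    ∣D∣<∣I∖J′∣ = unmatched⇒∣NI∖NJ∣<∣I∖J∣ (x∈p∩q⁺ (v∈I , x∉p⇒x∈∁p (v∉J ∘ p∩q⊆q I J))) unmatched
    ∣J′∣≤∣I∩J′∣ : ∣ J′ ∣ ≤ ∣ I ∩ J′ ∣
    ∣J′∣≤∣I∩J′∣ = p⊆q⇒∣p∣≤∣q∣ λ x∈J′ → x∈p∩q⁺ (p∩q⊆p I J x∈J′ , x∈J′)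
    ∣NI∣≤∣NJ′∣+∣D∣ : ∣ NI ∣ ≤ ∣ N G J′ ∣ + ∣ D ∣
    ∣NI∣≤∣NJ′∣+∣D∣ = begin
      ∣ NI ∣                   ≡⟨ ∣p∣≡∣p∩q∣+∣p∩∁q∣ NI (N G J′) ⟩
      ∣ NI ∩ N G J′ ∣ + ∣ D ∣  ≤⟨ +-monoˡ-≤ (∣ D ∣) (∣p∩q∣≤∣q∣ NI (N G J′)) ⟩
      ∣ N G J′ ∣ + ∣ D ∣       ∎
    swap : ∀ a b c → a + (b + c) ≡ a + c + b
    swap a b c = trans (cong (a +_) (+-comm b c)) (sym (+-assoc a c b))

module _ {n : ℕ} (G : Graph n) {I : Subset n} (I-critical : Critical G I)
         {M : List (Fin n × Fin n)} (M-maximum : IsMaxMatchingIn G (Lset G I) M) where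

  private
    L NI : Subset n
    L  = Lset G I
    NI = N G I

    I-independent : Independent G I
    I-independent = proj₁ I-critical

    M-disjoint : AllPairs (DisjointEdges G) M
    M-disjoint = proj₂ (proj₁ M-maximum)

    L∖I⊆NI : ∀ {x} → x ∈ L → x ∉ I → x ∈ NI
    L∖I⊆NI {x} x∈L x∉I with x∈p∪q⁻ I NI x∈L
    ... | inj₁ x∈I  = contradiction x∈I x∉I
    ... | inj₂ x∈NI = x∈NI

  ∣NI∣≤length : ∣ NI ∣ ≤ length M
  ∣NI∣≤length = subst (_≤ length M) (length-edges G NI⇉I)
    (proj₂ M-maximum (edges G NI⇉I) (edges-IsMatchingIn G NI⇉I NI∩I-empty (q⊆p∪q I NI) (p⊆p∪q NI)))
    where
    NI⇉I : MatchingInto G NI I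
    NI⇉I = hall G (Critical⇒HallCondition G I-critical)
    NI∩I-empty : ∀ {x} → x ∈ NI → x ∉ I
    NI∩I-empty = N-disjoint G I-independent (λ x∈I → x∈I)

  private
    end∈NI∖u : ∀ {u x y} → adj G x y ≡ true → x ∈ L → y ∈ L →
               ¬ (∃ λ w → w ∈ I × Joins u w (x , y)) → x ∈ NI ∩ ∁ ⁅ u ⁆ ⊎ y ∈ NI ∩ ∁ ⁅ u ⁆
    end∈NI∖u {u} {x} {y} xy x∈L y∈L no-I-partner with x ∈? I | x ≟ u
    ... | yes x∈I | _ = inj₂ (x∈p∧x≢y⇒x∈p∩∁⁅y⁆ (L∖I⊆NI y∈L y∉I) y≢u)
      where
      y∉I : y ∉ I
      y∉I y∈I = nonadjacent G I-independent x∈I y∈I xy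
      y≢u : y ≢ u
      y≢u y≡u = no-I-partner (x , x∈I , inj₂ (y≡u , refl))
    ... | no x∉I | no x≢u = inj₁ (x∈p∧x≢y⇒x∈p∩∁⁅y⁆ (L∖I⊆NI x∈L x∉I) x≢u)
    ... | no x∉I | yes x≡u = inj₂ (x∈p∧x≢y⇒x∈p∩∁⁅y⁆ (L∖I⊆NI y∈L y∉I) y≢u)
      where
      y∉I : y ∉ I
      y∉I y∈I = no-I-partner (y , y∈I , inj₁ (x≡u , refl))
      y≢u : y ≢ u
      y≢u y≡u = adj⇒≢ G xy (trans x≡u (sym y≡u))

  -- If some u ∈ N(I) had no partner in I, every edge of M would have an end in
  -- N(I) - u, so M would be smaller than the matching of N(I) into I given by Hall.
  NI-matched-into-I : ∀ {u} → u ∈ NI → ∃ λ w → w ∈ I × Matched M u w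
  NI-matched-into-I {u} u∈NI with any? (λ w → (w ∈? I) ×-dec Any.any? (joins? u w) M)
  ... | yes found = found
  ... | no  none  = contradiction (begin-strict
    length M               ≤⟨ length≤∣cover∣ G (NI ∩ ∁ ⁅ u ⁆) M-disjoint covered ⟩
    ∣ NI ∩ ∁ ⁅ u ⁆ ∣       <⟨ x∈p⇒∣p∩∁⁅x⁆∣<∣p∣ u∈NI ⟩
    ∣ NI ∣                 ≤⟨ ∣NI∣≤length ⟩
    length M               ∎) (<-irrefl refl)
    where
    no-I-partner : All (λ e → ¬ (∃ λ w → w ∈ I × Joins u w e)) M
    no-I-partner = All.tabulate λ e∈M (w , w∈I , joins) →
      none (w , w∈I , Any.map (λ e≡f → subst (Joins u w) e≡f joins) e∈M)
    covered : All (λ e → proj₁ e ∈ NI ∩ ∁ ⁅ u ⁆ ⊎ proj₂ e ∈ NI ∩ ∁ ⁅ u ⁆) M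
    covered = All.zipWith (λ ((xy , x∈L , y∈L) , ¬joins) → end∈NI∖u xy x∈L y∈L ¬joins)
                          (proj₁ (proj₁ M-maximum) , no-I-partner)

  mate-Matched : ∀ {u} → u ∈ NI → mate M u ∈ I × Matched M u (mate M u)
  mate-Matched {u} u∈NI =
    let w , w∈I , matched = NI-matched-into-I u∈NI in
    subst (λ w → w ∈ I × Matched M u w) (MapsTo⇒≡mate G M-disjoint (inj₁ matched)) (w∈I , matched)

  mate-MatchingInto : MatchingInto G NI I
  mate-MatchingInto = record
    { partner           = mate M
    ; partner∈          = proj₁ ∘ mate-Matched
    ; partner-adj       = Matched-adj G (proj₁ M-maximum) ∘ proj₂ ∘ mate-Matched
    ; partner-injective = λ {u} {u′} u∈NI u′∈NI mu≡mu′ →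
        Matched-functional G M-disjoint (Matched-sym (proj₂ (mate-Matched u∈NI)))
          (subst (λ w → Matched M w u′) (sym mu≡mu′) (Matched-sym (proj₂ (mate-Matched u′∈NI))))
    }

mainTheorem2 : ∀ {n : ℕ} (G : Graph n) (I : Subset n) → MaxCritical G I →
    ∀ (M : List (Fin n × Fin n)) → IsMaxMatchingIn G (Lset G I) M →
    ∀ (v : Fin n) →
      InCore G v ⇔
        (InCoreIn G (Lcset G I) v
          ⊎ InImage M (λ u → u ∈ N G I × ¬ InCorona G u) v
          ⊎ InKer G v)
mainTheorem2 G I (I-critical , _) M M-maximum v = mk⇔ core⇒ ⇒core
  where
  NI⇉I : MatchingInto G (N G I) I
  NI⇉I = mate-MatchingInto G I-critical M-maximum
  open Decomposition G I-critical NI⇉I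

  InUnion : Set
  InUnion = InCoreIn G (Lcset G I) v ⊎ InImage M (λ u → u ∈ N G I × ¬ InCorona G u) v ⊎ InKer G v

  core⇒ : InCore G v → InUnion
  core⇒ v∈core with v ∈? Lset G I
  ... | no  v∉L = inj₁ (InCore⇒InCoreIn-Lc v∈core (x∉p⇒x∈∁p v∉L))
  ... | yes v∈L with any? (λ u → (u ∈? N G I) ×-dec (mate M u ≟ v))
  ...   | yes (u , u∈NI , refl) = inj₂ (inj₁ (u , (u∈NI , u∉corona) , MapsTo-mate M u))
    where
    u∉corona : ¬ InCorona G u
    u∉corona = neighbour-of-InCore⇒¬InCorona G (MatchingInto.partner-adj NI⇉I u∈NI) v∈core
  ...   | no  unmatched =
    inj₂ (inj₂ (unmatched⇒InKer (InCore∩L⊆I v∈core v∈L) λ u∈NI mu≡v → unmatched (_ , u∈NI , mu≡v)))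

  ⇒core : InUnion → InCore G v
  ⇒core (inj₁ v∈core[Lc])                          = InCoreIn-Lc⇒InCore v∈core[Lc]
  ⇒core (inj₂ (inj₁ (u , (u∈NI , u∉corona) , u↦v))) =
    subst (InCore G) (sym (MapsTo⇒≡mate G (proj₂ (proj₁ M-maximum)) u↦v)) (partner-InCore u∈NI u∉corona)
  ⇒core (inj₂ (inj₂ v∈ker))                        = InKer⇒InCore v∈ker
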